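{- Let $k\geq 2$ and $1\leq x\leq 2k-1$ be integers, $n=2k+x$, and consider a $p$-labeled packing of $k$ copies of $C_n$ into $K_n$. Let $q$ be the minimum, over the $p$ labels, of the number of vertices carrying that label. If $q=1$ or $q\leq \frac{x}{2}$, then $p\leq x+2$.
   Context: $C_n$ is the cycle on $n$ vertices and $K_n$ the complete graph on $n$ vertices. A $p$-labeled packing of $k$ copies of $C_n$ into $K_n$ is a map $f$ from $V(K_n)$ onto a set of exactly $p$ labels together with injections (here bijections) $\sigma_1,\dots,\sigma_k:V(C_n)\to V(K_n)$ such that for $i\neq j$ the induced edge images $\sigma_i^*(E(C_n))$ and $\sigma_j^*(E(C_n))$ are disjoint, and for every $v\in V(C_n)$, $f(\sigma_1(v))=\dots=f(\sigma_k(v))$. Each vertex $v$ of $C_n$ carries the label $f(\sigma_1(v))$. -}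

module Defs where

open import Data.Nat using (ℕ; zero; suc; _+_; _*_; _≤_; NonZero)
open import Data.Nat.DivMod using (_%_)
open import Data.Fin using (Fin; toℕ; fromℕ<)
open import Data.Fin.Properties as FinP using ()
open import Data.List using (List; length; filter)
open import Data.List using () renaming (allFin to allFinL)
open import Data.Nat.DivMod using (m%n<n)
open import Data.Product using (Σ; _×_; _,_; ∃)
open import Data.Sum using (_⊎_)
open import Data.Empty using (⊥)
open import Relation.Nullary using (¬_)
open import Relation.Binary.PropositionalEquality using (_≡_)
open import Function.Definitions using (Injective; Surjective)

-- Vertices of C_n and K_n are both Fin n.
-- Successor mod n on Fin n (n ≥ 1): the cycle C_n has edges {i, i+1 mod n}.
next : ∀ {n} → Fin n → Fin n
next {suc n} i = fromℕ< (m%n<n (suc (toℕ i)) (suc n))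

SamePair : ∀ {n} → Fin n → Fin n → Fin n → Fin n → Set
SamePair a b c d = (a ≡ c × b ≡ d) ⊎ (a ≡ d × b ≡ c)

EdgeDisjoint : ∀ {n} → (Fin n → Fin n) → (Fin n → Fin n) → Set
EdgeDisjoint {n} σ τ =
  (u w : Fin n) → ¬ SamePair (σ u) (σ (next u)) (τ w) (τ (next w))

record LabeledPacking (n k p : ℕ) : Set where
  field
    f         : Fin n → Fin p
    f-onto    : Surjective _≡_ _≡_ f
    σ         : Fin k → Fin n → Fin n
    σ-inj     : (i : Fin k) → Injective _≡_ _≡_ (σ i)
    disjoint  : (i j : Fin k) → ¬ i ≡ j → EdgeDisjoint (σ i) (σ j)
    labelsAgree : (i j : Fin k) (v : Fin n) → f (σ i v) ≡ f (σ j v)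

first : ∀ {k} → .{{NonZero k}} → Fin k
first {suc k} = Data.Fin.zero

vertexLabel : ∀ {n k p} → .{{NonZero k}} → LabeledPacking n k p → Fin n → Fin p
vertexLabel P v = LabeledPacking.f P (LabeledPacking.σ P first v)

labelCount : ∀ {n k p} → .{{NonZero k}} → LabeledPacking n k p → Fin p → ℕ
labelCount {n} P l = length (filter (λ v → vertexLabel P v FinP.≟ l) (allFinL n))

IsMinCount : ∀ {n k p} → .{{NonZero k}} → LabeledPacking n k p → ℕ → Set
IsMinCount {p = p} P q =
  (Σ (Fin p) λ l → labelCount P l ≡ q) × ((l : Fin p) → q ≤ labelCount P l)

module Submission where

-- Fix a label A of minimum multiplicity q and a vertex u of K_n labelled A.  Each copy is a
-- Hamiltonian cycle through u and the copies are edge-disjoint, so u together with its two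
-- neighbours in each copy gives 2k + 1 distinct vertices.  Since every copy induces the same
-- labelling of C_n, each of them carries A or the label of a cycle-neighbour of one of the q
-- vertices of C_n labelled A: at most 2q + 1 labels.  Each of the remaining a labels needs q
-- further vertices, so a q + 2k + 1 ≤ 2k + x, and p ≤ a + 2q + 1 ≤ x + 2 when q = 1 or 2q ≤ x.

open import Defs
open import Data.Bool.Base using (Bool; true; false; not; _∧_; _∨_; T)
open import Data.Bool.Properties using (T-∧; T-∨)
open import Data.Empty using (⊥-elim)
open import Data.Fin.Base using (Fin; zero; suc; toℕ; fromℕ; inject₁; punchIn; punchOut; splitAt; join)
open import Data.Fin.Properties
  using (_≟_; any?; toℕ-injective; toℕ-fromℕ; toℕ-fromℕ<; toℕ-inject₁; toℕ<n;
         punchIn-punchOut; punchOut-injective; punchInᵢ≢i; injective⇒≤; join-splitAt)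
import Data.Fin.Properties as Fin
open import Data.Fin.Relation.Unary.Top using (view; ‵fromℕ; ‵inject₁)
open import Data.List.Base using (length; filter; tabulate)
open import Data.Nat.Base using (ℕ; zero; suc; _+_; _*_; _∸_; _≤_; _<_; z≤n; s≤s; s≤s⁻¹; NonZero; >-nonZero)
open import Data.Nat.DivMod using (_%_; m<n⇒m%n≡m; n%n≡0)
open import Data.Nat.Properties hiding (_≟_)
open import Algebra.Properties.CommutativeSemigroup +-commutativeSemigroup
  using (interchange; x∙yz≈y∙xz)
open import Data.Nat.Tactic.RingSolver using (solve-∀)
open import Data.Product using (_×_; _,_; proj₁; proj₂; ∃₂)
open import Data.Sum as Sum using (_⊎_; inj₁; inj₂)
open import Data.Vec.Functional using (_∷_; foldr)
open import Function.Base using (_∘_; id; const)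
open import Function.Bundles using (Equivalence)
open import Function.Definitions using (Injective; Surjective)
open import Relation.Nullary using (¬_; Dec; yes; no; contradiction)
open import Relation.Nullary.Decidable using (⌊_⌋; fromWitness; toWitness; T?)
open import Relation.Binary.PropositionalEquality

prev : ∀ {m} → Fin (suc m) → Fin (suc m)
prev {m} zero = fromℕ m
prev (suc j) = inject₁ j

next-fromℕ : ∀ {m} → next (fromℕ m) ≡ zero
next-fromℕ {m} = toℕ-injective (begin
  toℕ (next (fromℕ m))   ≡⟨ toℕ-fromℕ< _ ⟩
  suc (toℕ (fromℕ m)) % suc m ≡⟨ cong (λ a → suc a % suc m) (toℕ-fromℕ m) ⟩
  suc m % suc m          ≡⟨ n%n≡0 (suc m) ⟩
  0                      ∎)
  where open ≡-Reasoning

next-inject₁ : ∀ {m} (j : Fin m) → next (inject₁ j) ≡ suc j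
next-inject₁ {m} j = toℕ-injective (begin
  toℕ (next (inject₁ j))         ≡⟨ toℕ-fromℕ< _ ⟩
  suc (toℕ (inject₁ j)) % suc m  ≡⟨ cong (λ a → suc a % suc m) (toℕ-inject₁ j) ⟩
  suc (toℕ j) % suc m            ≡⟨ m<n⇒m%n≡m (s≤s (toℕ<n j)) ⟩
  suc (toℕ j)                    ∎)
  where open ≡-Reasoning

next-prev : ∀ {m} (v : Fin (suc m)) → next (prev v) ≡ v
next-prev zero = next-fromℕ
next-prev (suc j) = next-inject₁ j

suc≢inject₁ : ∀ {m} (j : Fin m) → suc j ≢ inject₁ j
suc≢inject₁ j e = 1+n≢n (trans (cong toℕ e) (toℕ-inject₁ j))

next≢id : ∀ {m} (v : Fin (2 + m)) → next v ≢ v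
next≢id v with view v
... | ‵fromℕ = Fin.0≢1+n ∘ trans (sym next-fromℕ)
... | ‵inject₁ j = suc≢inject₁ j ∘ trans (sym (next-inject₁ j))

prev≢id : ∀ {m} (v : Fin (2 + m)) → prev v ≢ v
prev≢id v e = next≢id v (trans (cong next (sym e)) (next-prev v))

next≢prev : ∀ {m} (v : Fin (3 + m)) → next v ≢ prev v
next≢prev v with view v
... | ‵fromℕ = Fin.0≢1+n ∘ trans (sym next-fromℕ)
... | ‵inject₁ zero = Fin.0≢1+n ∘ Fin.suc-injective ∘ trans (sym (next-inject₁ zero))
... | ‵inject₁ (suc j) = λ e → m≢1+n+m (toℕ j) (sym (begin
  suc (suc (toℕ j))            ≡⟨ cong toℕ (trans (sym (next-inject₁ (suc j))) e) ⟩
  toℕ (inject₁ (inject₁ j))    ≡⟨ toℕ-inject₁ (inject₁ j) ⟩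
  toℕ (inject₁ j)              ≡⟨ toℕ-inject₁ j ⟩
  toℕ j                        ∎))
  where open ≡-Reasoning

bit : Bool → ℕ
bit false = 0
bit true = 1

count : ∀ {n} → (Fin n → Bool) → ℕ
count {zero} P = 0
count {suc n} P = bit (P zero) + count (P ∘ suc)

fibre : ∀ {n p} → (Fin n → Fin p) → Fin p → ℕ
fibre g l = count (λ w → ⌊ g w ≟ l ⌋)

bit-T : ∀ {b} → T b → bit b ≡ 1
bit-T {true} _ = refl

bit-mono : ∀ {a b} → (T a → T b) → bit a ≤ bit b
bit-mono {false} _ = z≤n
bit-mono {true} {true} _ = ≤-refl
bit-mono {true} {false} a⇒b = ⊥-elim (a⇒b _)

bit-split : ∀ a b → bit a ≡ bit (a ∧ b) + bit (a ∧ not b)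
bit-split false _ = refl
bit-split true false = refl
bit-split true true = refl

count-none : ∀ {n} (P : Fin n → Bool) → (∀ i → ¬ T (P i)) → count P ≡ 0
count-none {zero} _ _ = refl
count-none {suc n} P none with P zero | none zero
... | false | _ = count-none (P ∘ suc) (none ∘ suc)
... | true | ¬T = ⊥-elim (¬T _)

count-true : ∀ n → count {n} (const true) ≡ n
count-true zero = refl
count-true (suc n) = cong suc (count-true n)

count-punchIn : ∀ {n} (P : Fin (suc n) → Bool) i → count P ≡ bit (P i) + count (P ∘ punchIn i)
count-punchIn P zero = refl
count-punchIn {suc n} P (suc i) = begin
  bit (P zero) + count (P ∘ suc)               ≡⟨ cong (bit (P zero) +_) (count-punchIn (P ∘ suc) i) ⟩
  bit (P zero) + (bit (P (suc i)) + rest)       ≡⟨ x∙yz≈y∙xz (bit (P zero)) (bit (P (suc i))) rest ⟩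
  bit (P (suc i)) + (bit (P zero) + rest)       ∎
  where
  open ≡-Reasoning
  rest = count (P ∘ suc ∘ punchIn i)

count-≤-injective : ∀ {m n} {P : Fin m → Bool} {Q : Fin n → Bool} (h : Fin m → Fin n) →
  Injective _≡_ _≡_ h → (∀ i → T (P i) → T (Q (h i))) → count P ≤ count Q
count-≤-injective {zero} _ _ _ = z≤n
count-≤-injective {suc m} {zero} h _ _ with h zero
... | ()
count-≤-injective {suc m} {suc n} {P} {Q} h h-inj P⇒Q = begin
  bit (P zero) + count (P ∘ suc)                 ≤⟨ +-mono-≤ (bit-mono (P⇒Q zero)) (count-≤-injective h′ h′-inj P⇒Q′) ⟩
  bit (Q (h zero)) + count (Q ∘ punchIn (h zero)) ≡⟨ count-punchIn Q (h zero) ⟨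
  count Q                                        ∎
  where
  open ≤-Reasoning
  h₀≢ : ∀ i → h zero ≢ h (suc i)
  h₀≢ i = Fin.0≢1+n ∘ h-inj
  h′ : Fin m → Fin n
  h′ i = punchOut (h₀≢ i)
  h′-inj : Injective _≡_ _≡_ h′
  h′-inj = Fin.suc-injective ∘ h-inj ∘ punchOut-injective (h₀≢ _) (h₀≢ _)
  P⇒Q′ : ∀ i → T (P (suc i)) → T (Q (punchIn (h zero) (h′ i)))
  P⇒Q′ i = subst (T ∘ Q) (sym (punchIn-punchOut (h₀≢ i))) ∘ P⇒Q (suc i)

count-mono : ∀ {n} (P Q : Fin n → Bool) → (∀ i → T (P i) → T (Q i)) → count P ≤ count Q
count-mono _ _ = count-≤-injective id id

count-split : ∀ {n} (P Q : Fin n → Bool) →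
  count P ≡ count (λ i → P i ∧ Q i) + count (λ i → P i ∧ not (Q i))
count-split {zero} _ _ = refl
count-split {suc n} P Q =
  trans (cong₂ _+_ (bit-split (P zero) (Q zero)) (count-split (P ∘ suc) (Q ∘ suc)))
        (interchange (bit (P zero ∧ Q zero)) (bit (P zero ∧ not (Q zero)))
                     (count (λ i → P (suc i) ∧ Q (suc i))) (count (λ i → P (suc i) ∧ not (Q (suc i)))))

count-not : ∀ {n} (P : Fin n → Bool) → count P + count (not ∘ P) ≡ n
count-not {n} P = trans (sym (count-split (const true) P)) (count-true n)

count-∨ : ∀ {n} (P Q : Fin n → Bool) → count (λ i → P i ∨ Q i) ≤ count P + count Q
count-∨ P Q = begin
  count P∨Q                                                    ≡⟨ count-split P∨Q P ⟩
  count (λ i → P∨Q i ∧ P i) + count (λ i → P∨Q i ∧ not (P i))  ≤⟨ +-mono-≤ left right ⟩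
  count P + count Q                                            ∎
  where
  open ≤-Reasoning
  P∨Q = λ i → P i ∨ Q i
  right-disjunct : ∀ a b → T ((a ∨ b) ∧ not a) → T b
  right-disjunct false b = proj₁ ∘ T-∧ .Equivalence.to
  left : count (λ i → P∨Q i ∧ P i) ≤ count P
  left = count-mono (λ i → P∨Q i ∧ P i) P λ i → proj₂ ∘ T-∧ .Equivalence.to
  right : count (λ i → P∨Q i ∧ not (P i)) ≤ count Q
  right = count-mono (λ i → P∨Q i ∧ not (P i)) Q λ i → right-disjunct (P i) (Q i)

count-∧-≟ : ∀ {n} {R : Fin n → Bool} {i} → T (R i) → count (λ j → R j ∧ ⌊ j ≟ i ⌋) ≡ 1
count-∧-≟ {suc n} {R} {i} Ri = begin
  count Rᵢ                             ≡⟨ count-punchIn Rᵢ i ⟩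
  bit (Rᵢ i) + count (Rᵢ ∘ punchIn i)  ≡⟨ cong₂ _+_ (bit-T (T-∧ .Equivalence.from (Ri , fromWitness refl)))
                                                    (count-none (Rᵢ ∘ punchIn i) elsewhere) ⟩
  1                                    ∎
  where
  open ≡-Reasoning
  Rᵢ = λ j → R j ∧ ⌊ j ≟ i ⌋
  elsewhere : ∀ j → ¬ T (Rᵢ (punchIn i j))
  elsewhere j = punchInᵢ≢i i j ∘ toWitness {a? = punchIn i j ≟ i} ∘ proj₂ ∘ T-∧ .Equivalence.to

count-singleton : ∀ {n} (i : Fin n) → count (λ j → ⌊ j ≟ i ⌋) ≡ 1
count-singleton {n} i = count-∧-≟ {n} {const true} {i} _

count-remove : ∀ {n} {R : Fin n → Bool} {i} → T (R i) →
  count R ≡ suc (count (λ j → R j ∧ not ⌊ j ≟ i ⌋))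
count-remove {R = R} {i} Ri =
  trans (count-split R (λ j → ⌊ j ≟ i ⌋)) (cong (_+ count (λ j → R j ∧ not ⌊ j ≟ i ⌋)) (count-∧-≟ {R = R} Ri))

surjective⇒0<fibre : ∀ {n p} {g : Fin n → Fin p} → Surjective _≡_ _≡_ g → ∀ l → 0 < fibre g l
surjective⇒0<fibre {g = g} g-onto l with g-onto l
... | w , gw≡l =
  subst (0 <_) (sym (count-remove {R = λ v → ⌊ g v ≟ l ⌋} (fromWitness (gw≡l refl)))) (s≤s z≤n)

count-fibres : ∀ {n p q} (g : Fin n → Fin p) (R : Fin p → Bool) →
  (∀ l → T (R l) → q ≤ fibre g l) → count R * q ≤ count (R ∘ g)
count-fibres {q = q} g R = go (count R) R refl
  where
  go : ∀ N R → count R ≡ N → (∀ l → T (R l) → q ≤ fibre g l) → N * q ≤ count (R ∘ g)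
  go zero R _ _ = z≤n
  go (suc N) R ∣R∣≡1+N large with any? (T? ∘ R)
  ... | no none = contradiction (trans (sym ∣R∣≡1+N) (count-none R λ l Rl → none (l , Rl))) λ ()
  ... | yes (l₀ , Rl₀) = begin
    q + N * q                                   ≤⟨ +-mono-≤ (≤-trans (large l₀ Rl₀) fibre≤) (go N R′ ∣R′∣≡N large′) ⟩
    count (R-at-l₀ ∘ g) + count (R′ ∘ g)        ≡⟨ count-split (R ∘ g) (λ w → ⌊ g w ≟ l₀ ⌋) ⟨
    count (R ∘ g)                               ∎
    where
    open ≤-Reasoning
    R-at-l₀ R′ : Fin _ → Bool
    R-at-l₀ l = R l ∧ ⌊ l ≟ l₀ ⌋
    R′ l = R l ∧ not ⌊ l ≟ l₀ ⌋
    ∣R′∣≡N : count R′ ≡ N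
    ∣R′∣≡N = suc-injective (trans (sym (count-remove {R = R} Rl₀)) ∣R∣≡1+N)
    large′ : ∀ l → T (R′ l) → q ≤ fibre g l
    large′ l = large l ∘ proj₁ ∘ T-∧ .Equivalence.to
    fibre≤ : fibre g l₀ ≤ count (R-at-l₀ ∘ g)
    fibre≤ = count-mono (λ w → ⌊ g w ≟ l₀ ⌋) (R-at-l₀ ∘ g) λ w gw≡l₀ →
      T-∧ .Equivalence.from (subst (T ∘ R) (sym (toWitness gw≡l₀)) Rl₀ , gw≡l₀)

image : ∀ {m p} → (Fin m → Bool) → (Fin m → Fin p) → Fin p → Bool
image S g l = foldr _∨_ false (λ v → S v ∧ ⌊ l ≟ g v ⌋)

∈-image : ∀ {m p} {S : Fin m → Bool} {g : Fin m → Fin p} {v} → T (S v) → T (image S g (g v))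
∈-image {v = zero} Sv = T-∨ .Equivalence.from (inj₁ (T-∧ .Equivalence.from (Sv , fromWitness refl)))
∈-image {S = S} {g} {suc v} Sv = T-∨ .Equivalence.from (inj₂ (∈-image {S = S ∘ suc} {g ∘ suc} Sv))

count-image : ∀ {m p} (S : Fin m → Bool) (g : Fin m → Fin p) → count (image S g) ≤ count S
count-image {zero} S g = ≤-reflexive (count-none (image S g) λ _ ())
count-image {suc m} S g = ≤-trans (count-∨ _ (image (S ∘ suc) (g ∘ suc)))
                                  (+-mono-≤ (single (S zero) (g zero)) (count-image (S ∘ suc) (g ∘ suc)))
  where
  single : ∀ {p} b (c : Fin p) → count (λ l → b ∧ ⌊ l ≟ c ⌋) ≤ bit b
  single false c = ≤-reflexive (count-none (λ l → false ∧ ⌊ l ≟ c ⌋) λ _ ())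
  single true c = ≤-reflexive (count-singleton c)

length-filter-tabulate : ∀ {a p} {A : Set a} {P : A → Set p} (P? : ∀ x → Dec (P x)) {n} (g : Fin n → A) →
  length (filter P? (tabulate g)) ≡ count (λ i → ⌊ P? (g i) ⌋)
length-filter-tabulate P? {zero} g = refl
length-filter-tabulate P? {suc n} g with P? (g zero)
... | yes _ = cong suc (length-filter-tabulate P? (g ∘ suc))
... | no _ = length-filter-tabulate P? (g ∘ suc)

q*outside+inside≤n : ∀ {m n p q} (g : Fin n → Fin p) (L : Fin p → Bool) (h : Fin m → Fin n) →
  Injective _≡_ _≡_ h → (∀ j → T (L (g (h j)))) → (∀ l → q ≤ fibre g l) →
  count (not ∘ L) * q + m ≤ n
q*outside+inside≤n {m} {n} {q = q} g L h h-inj inside large = begin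
  count (not ∘ L) * q + m                  ≤⟨ +-mono-≤ (count-fibres g (not ∘ L) (λ l _ → large l)) inside-count ⟩
  count (not ∘ L ∘ g) + count (L ∘ g)      ≡⟨ +-comm _ (count (L ∘ g)) ⟩
  count (L ∘ g) + count (not ∘ L ∘ g)      ≡⟨ count-not (L ∘ g) ⟩
  n                                        ∎
  where
  open ≤-Reasoning
  inside-count : m ≤ count (L ∘ g)
  inside-count = subst (_≤ count (L ∘ g)) (count-true m) (count-≤-injective h h-inj λ j _ → inside j)

injective⇒surjective : ∀ {n} {s : Fin n → Fin n} → Injective _≡_ _≡_ s → Surjective _≡_ _≡_ s
injective⇒surjective {suc n} {s} s-inj w with any? (λ v → s v ≟ w)
... | yes (v , sv≡w) = v , λ { refl → sv≡w }
... | no miss = contradiction (injective⇒≤ punched-inj) 1+n≰n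
  where
  w≢s : ∀ v → w ≢ s v
  w≢s v w≡sv = miss (v , sym w≡sv)
  punched-inj : Injective _≡_ _≡_ (λ v → punchOut (w≢s v))
  punched-inj = s-inj ∘ punchOut-injective (w≢s _) (w≢s _)

∷-injective : ∀ {a} {A : Set a} {n} {c : A} {h : Fin n → A} →
  (∀ j → c ≢ h j) → Injective _≡_ _≡_ h → Injective _≡_ _≡_ (c ∷ h)
∷-injective _ _ {zero} {zero} _ = refl
∷-injective c∉h _ {zero} {suc j} c≡hj = ⊥-elim (c∉h j c≡hj)
∷-injective c∉h _ {suc i} {zero} hi≡c = ⊥-elim (c∉h i (sym hi≡c))
∷-injective _ h-inj {suc i} {suc j} hi≡hj = cong suc (h-inj hi≡hj)

splitAt-injective : ∀ m {n} → Injective _≡_ _≡_ (splitAt m {n})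
splitAt-injective m {n} {i} {j} e =
  trans (sym (join-splitAt m n i)) (trans (cong (join m n) e) (join-splitAt m n j))

a+b≤x+2 : ∀ {a b q x} → 1 ≤ q → b ≤ suc (q + q) → a * q < x → q ≡ 1 ⊎ 2 * q ≤ x → a + b ≤ x + 2
a+b≤x+2 {a} {b} {x = x} _ b≤ aq<x (inj₁ refl) = begin
  a + b      ≤⟨ +-monoʳ-≤ a b≤ ⟩
  a + 3      ≡⟨ +-suc a 2 ⟩
  suc a + 2  ≤⟨ +-monoˡ-≤ 2 (subst (_< x) (*-identityʳ a) aq<x) ⟩
  x + 2      ∎
  where open ≤-Reasoning
a+b≤x+2 {a} {b} {q} {x} 1≤q b≤ aq<x (inj₂ 2q≤x) = begin
  a + b                ≤⟨ +-mono-≤ a≤1+t b≤ ⟩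
  suc t + suc (q + q)  ≡⟨ rearrange t q ⟩
  (2 * q + t) + 2      ≡⟨ cong (_+ 2) (m+[n∸m]≡n 2q≤x) ⟩
  x + 2                ∎
  where
  open ≤-Reasoning
  t = x ∸ 2 * q
  rearrange : ∀ t q → suc t + suc (q + q) ≡ (2 * q + t) + 2
  rearrange = solve-∀
  x≤[2+t]q : x ≤ (2 + t) * q
  x≤[2+t]q = begin
    x              ≡⟨ m+[n∸m]≡n 2q≤x ⟨
    2 * q + t      ≤⟨ +-monoʳ-≤ (2 * q) (m≤m*n t q {{>-nonZero 1≤q}}) ⟩
    2 * q + t * q  ≡⟨ *-distribʳ-+ q 2 t ⟨
    (2 + t) * q    ∎
  a≤1+t : a ≤ suc t
  a≤1+t = s≤s⁻¹ (*-cancelʳ-< q a (2 + t) (<-≤-trans aq<x x≤[2+t]q))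

module _ {n k p} .{{_ : NonZero k}} (P : LabeledPacking n k p) where
  open LabeledPacking P

  position : Fin k → Fin n → Fin n
  position i w = proj₁ (injective⇒surjective (σ-inj i) w)

  σ-position : ∀ i w → σ i (position i w) ≡ w
  σ-position i w = proj₂ (injective⇒surjective (σ-inj i) w) refl

  vertexLabel-position : ∀ i w → vertexLabel P (position i w) ≡ f w
  vertexLabel-position i w = trans (labelsAgree first i _) (cong f (σ-position i w))

  vertexLabel-surjective : Surjective _≡_ _≡_ (vertexLabel P)
  vertexLabel-surjective l =
    position first w , λ { refl → trans (vertexLabel-position first w) (proj₂ (f-onto l) refl) }
    where w = proj₁ (f-onto l)

  labelCount≡fibre : ∀ l → labelCount P l ≡ fibre (vertexLabel P) l
  labelCount≡fibre l = length-filter-tabulate (λ v → vertexLabel P v ≟ l) id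

  fibre-vertexLabel≤fibre : ∀ l → fibre (vertexLabel P) l ≤ fibre f l
  fibre-vertexLabel≤fibre l = count-≤-injective (σ first) (σ-inj first) (λ _ → id)

  minCount-positive : ∀ {q} → IsMinCount P q → 1 ≤ q
  minCount-positive ((A , ∣A∣≡q) , _) =
    subst (1 ≤_) (trans (sym (labelCount≡fibre A)) ∣A∣≡q) (surjective⇒0<fibre vertexLabel-surjective A)

module _ {m k p} .{{_ : NonZero k}} (P : LabeledPacking (3 + m) k p) (u : Fin (3 + m)) where
  open LabeledPacking P

  neighbour : Fin k ⊎ Fin k → Fin (3 + m)
  neighbour (inj₁ i) = σ i (next (position P i u))
  neighbour (inj₂ i) = σ i (prev (position P i u))

  σ-next-prev : ∀ i → σ i (next (prev (position P i u))) ≡ u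
  σ-next-prev i = trans (cong (σ i) (next-prev _)) (σ-position P i u)

  neighbour-injective : Injective _≡_ _≡_ neighbour
  neighbour-injective {inj₁ i} {inj₁ j} e with i ≟ j
  ... | yes i≡j = cong inj₁ i≡j
  ... | no i≢j = ⊥-elim (disjoint i j i≢j (position P i u) (position P j u)
                          (inj₁ (trans (σ-position P i u) (sym (σ-position P j u)) , e)))
  neighbour-injective {inj₁ i} {inj₂ j} e with i ≟ j
  ... | yes refl = ⊥-elim (next≢prev (position P i u) (σ-inj i e))
  ... | no i≢j = ⊥-elim (disjoint i j i≢j (position P i u) (prev (position P j u))
                          (inj₂ (trans (σ-position P i u) (sym (σ-next-prev j)) , e)))
  neighbour-injective {inj₂ i} {inj₁ j} e = sym (neighbour-injective (sym e))
  neighbour-injective {inj₂ i} {inj₂ j} e with i ≟ j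
  ... | yes i≡j = cong inj₂ i≡j
  ... | no i≢j = ⊥-elim (disjoint i j i≢j (prev (position P i u)) (prev (position P j u))
                          (inj₁ (e , trans (σ-next-prev i) (sym (σ-next-prev j)))))

  u≢neighbour : ∀ s → u ≢ neighbour s
  u≢neighbour (inj₁ i) e = next≢id (position P i u) (sym (σ-inj i (trans (σ-position P i u) e)))
  u≢neighbour (inj₂ i) e = prev≢id (position P i u) (sym (σ-inj i (trans (σ-position P i u) e)))

  star : Fin (suc (k + k)) → Fin (3 + m)
  star = u ∷ neighbour ∘ splitAt k

  star-injective : Injective _≡_ _≡_ star
  star-injective = ∷-injective (u≢neighbour ∘ splitAt k) (splitAt-injective k ∘ neighbour-injective)

  labelClass : Fin (3 + m) → Bool
  labelClass v = ⌊ vertexLabel P v ≟ f u ⌋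

  closeLabels : Fin p → Bool
  closeLabels l = ⌊ l ≟ f u ⌋ ∨ image labelClass (vertexLabel P ∘ next) l
                              ∨ image labelClass (vertexLabel P ∘ prev) l

  ∈-closeLabels : ∀ {l} → l ≡ f u ⊎ T (image labelClass (vertexLabel P ∘ next) l)
                                  ⊎ T (image labelClass (vertexLabel P ∘ prev) l) → T (closeLabels l)
  ∈-closeLabels {l} = T-∨ .Equivalence.from ∘ Sum.map (fromWitness {a? = l ≟ f u}) (T-∨ .Equivalence.from)

  labelClass-position : ∀ i → T (labelClass (position P i u))
  labelClass-position i = fromWitness (vertexLabel-position P i u)

  neighbour-closeLabels : ∀ s → T (closeLabels (f (neighbour s)))
  neighbour-closeLabels (inj₁ i) = subst (T ∘ closeLabels) (labelsAgree first i _)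
    (∈-closeLabels (inj₂ (inj₁ (∈-image {S = labelClass} {vertexLabel P ∘ next} (labelClass-position i)))))
  neighbour-closeLabels (inj₂ i) = subst (T ∘ closeLabels) (labelsAgree first i _)
    (∈-closeLabels (inj₂ (inj₂ (∈-image {S = labelClass} {vertexLabel P ∘ prev} (labelClass-position i)))))

  star-closeLabels : ∀ j → T (closeLabels (f (star j)))
  star-closeLabels zero = ∈-closeLabels (inj₁ refl)
  star-closeLabels (suc j) = neighbour-closeLabels (splitAt k j)

  count-closeLabels : count closeLabels ≤ suc (fibre (vertexLabel P) (f u) + fibre (vertexLabel P) (f u))
  count-closeLabels = ≤-trans (count-∨ (λ l → ⌊ l ≟ f u ⌋) _)
    (+-mono-≤ (≤-reflexive (count-singleton (f u)))
              (≤-trans (count-∨ (image labelClass (vertexLabel P ∘ next)) _)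
                       (+-mono-≤ (count-image labelClass (vertexLabel P ∘ next))
                                 (count-image labelClass (vertexLabel P ∘ prev)))))

label-partition : ∀ {n k p q} .{{_ : NonZero k}} → 3 ≤ n → (P : LabeledPacking n k p) → IsMinCount P q →
  ∃₂ λ a b → p ≡ a + b × b ≤ suc (q + q) × a * q + suc (k + k) ≤ n
label-partition {1} (s≤s ()) _ _
label-partition {2} (s≤s (s≤s ())) _ _
label-partition {suc (suc (suc m))} {p = p} {q = q} _ P ((A , ∣A∣≡q) , minimal) =
  count (not ∘ L) , count L , p≡a+b , subst (λ c → count L ≤ suc (c + c)) fibre≡q (count-closeLabels P u) ,
  q*outside+inside≤n f L (star P u) (star-injective P u) (star-closeLabels P u) large
  where
  open LabeledPacking P
  u = proj₁ (f-onto A)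
  L = closeLabels P u
  p≡a+b : p ≡ count (not ∘ L) + count L
  p≡a+b = sym (trans (+-comm _ (count L)) (count-not L))
  fibre≡q : fibre (vertexLabel P) (f u) ≡ q
  fibre≡q = trans (cong (fibre (vertexLabel P)) (proj₂ (f-onto A) refl)) (trans (sym (labelCount≡fibre P A)) ∣A∣≡q)
  large : ∀ l → q ≤ fibre f l
  large l = ≤-trans (subst (q ≤_) (labelCount≡fibre P l) (minimal l)) (fibre-vertexLabel≤fibre P l)

mainTheorem3 : (k x p q : ℕ) → .{{_ : NonZero k}} → 2 ≤ k → 1 ≤ x → x ≤ 2 * k ∸ 1 →
    (P : LabeledPacking (2 * k + x) k p) →
    IsMinCount P q → (q ≡ 1 ⊎ 2 * q ≤ x) → p ≤ x + 2
mainTheorem3 k x p q 2≤k 1≤x _ P minCount q-small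
  with a , b , refl , b≤1+2q , aq+1+2k≤n ← label-partition (+-mono-≤ (≤-trans 2≤k (m≤n*m k 2)) 1≤x) P minCount
  = a+b≤x+2 (minCount-positive P minCount) b≤1+2q
            (+-cancelˡ-≤ (2 * k) _ _ (subst (_≤ 2 * k + x) (reorder a q k) aq+1+2k≤n)) q-small
  where
  reorder : ∀ a q k → a * q + suc (k + k) ≡ 2 * k + suc (a * q)
  reorder = solve-∀
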